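{- Let $k\geq 3$ and let $h_1\geq h_4\geq h_5\geq\dots\geq h_k>0$ be integers. Then an $\mathrm{ROS}(h_1^3h_4\dots h_k)$ exists, i.e. an $\mathrm{ROS}$ for the sequence $(h_1,h_1,h_1,h_4,\dots,h_k)$.
   Context: Given a sequence $P=(p_1,\dots,p_k)$ of positive integers, an $\mathrm{ROS}(P)$ (symmetric rational outline square respecting $P$) is an assignment of a non-negative rational number $O(i,j,\ell)$ to every multiset $\{i,j,\ell\}$ of elements of $[k]=\{1,\dots,k\}$ (so the value is invariant under permuting $i,j,\ell$) such that $\sum_{\ell\in[k]}O(i,j,\ell)=p_ip_j$ for all $i,j\in[k]$, and $O(i,i,i)=p_i^2$ and $O(i,i,j)=0$ for all $i\neq j$. The notation $h^m$ means $m$ parts equal to $h$. -}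

module Defs where

open import Data.Nat as ℕ using (ℕ; zero; suc)
open import Data.Fin using (Fin; zero; suc)
open import Data.Rational using (ℚ; 0ℚ; _+_; _*_; _≤_)
open import Data.Product using (Σ; _×_)
open import Relation.Binary.PropositionalEquality using (_≡_; _≢_)

ℕ→ℚ : ℕ → ℚ
ℕ→ℚ n = Data.Rational.mkℚ+ n 1 (Data.Nat.Coprimality.sym (Data.Nat.Coprimality.1-coprimeTo n))
  where import Data.Nat.Coprimality

sumFin : (k : ℕ) → (Fin k → ℚ) → ℚ
sumFin zero    f = 0ℚ
sumFin (suc k) f = f zero + sumFin k (λ i → f (suc i))

-- O is a function of ordered triples required to be invariant under all
-- permutations (generated by the two transpositions), i.e. a function of multisets.
record IsROS (k : ℕ) (P : Fin k → ℕ) (O : Fin k → Fin k → Fin k → ℚ) : Set where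
  field
    symm₁₂  : ∀ i j l → O i j l ≡ O j i l
    symm₂₃  : ∀ i j l → O i j l ≡ O i l j
    nonneg  : ∀ i j l → 0ℚ ≤ O i j l
    lineSum : ∀ i j → sumFin k (λ l → O i j l) ≡ ℕ→ℚ (P i ℕ.* P j)
    diag    : ∀ i → O i i i ≡ ℕ→ℚ (P i ℕ.* P i)
    offdiag : ∀ i j → i ≢ j → O i i j ≡ 0ℚ

ROS : (k : ℕ) → (Fin k → ℕ) → Set
ROS k P = Σ (Fin k → Fin k → Fin k → ℚ) (IsROS k P)

seq3 : (h₁ : ℕ) (m : ℕ) → (Fin m → ℕ) → Fin (3 ℕ.+ m) → ℕ
seq3 h₁ m hs zero                   = h₁
seq3 h₁ m hs (suc zero)             = h₁
seq3 h₁ m hs (suc (suc zero))       = h₁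
seq3 h₁ m hs (suc (suc (suc i)))    = hs i

{- Dividing by h₁ reduces the theorem to t = (1, 1, 1, h₄/h₁, …, h_k/h₁) ∈ [0,1]^k: it suffices to find a
   hollow outline W for t (symmetric, non-negative, zero whenever two indices coincide, with
   Σ_l W(i,j,l) = tᵢtⱼ for i ≠ j), since h₁²W plus the diagonal O(i,i,i) = hᵢ² is then an ROS.
   For i ≠ j the product tᵢtⱼ is affine in each coordinate t_b, so hollow outlines for t with t_b replaced
   by 0 and by 1, weighted by 1 − t_b and t_b, combine into one for t. Coordinate by coordinate this leaves
   only 0/1 vectors, and for those W(i,j,l) = tᵢtⱼt_l / (Σt − 2) on pairwise distinct i, j, l works;
   Σt − 2 > 0 because the first three entries are 1. -}

module Submission where

open import Defs

module RationalOutlineSquares where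

  open import Algebra.Bundles using (Ring)
  open import Data.Empty using (⊥-elim)
  open import Data.Fin.Base using (Fin; zero; suc)
  open import Data.Fin.Properties using (_≟_)
  import Data.Integer.Base as ℤ
  import Data.Integer.Properties as ℤ
  open import Data.List.Base as List using (List; []; allFin)
  open import Data.List.Membership.Propositional using (_∈_)
  open import Data.List.Membership.Propositional.Properties using (∈-allFin)
  open import Data.List.Relation.Unary.Any using (here; there)
  open import Data.Nat.Base as ℕ using (ℕ; zero; suc)
  open import Data.Product.Base using (Σ; _×_; _,_; proj₁)
  open import Data.Rational.Base
    using (ℚ; 0ℚ; 1ℚ; _+_; _*_; -_; _-_; 1/_; _/_; _÷_; _≤_; NonZero; Positive; nonNegative; *≤*)
  import Data.Rational.Properties as ℚ
  open import Data.Rational.Solver using (module +-*-Solver)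
  open import Data.Sum.Base using (_⊎_; inj₁; inj₂; [_,_]′)
  open import Data.Vec.Functional using (Vector; _∷_; updateAt)
  open import Data.Vec.Functional.Properties using (updateAt-updates; updateAt-minimal)
  open import Function.Base using (const; id; _∘_)
  open import Relation.Binary.PropositionalEquality
  open import Relation.Nullary using (yes; no)

  open import Algebra.Properties.Semiring.Sum (Ring.semiring ℚ.+-*-ring)
    using (sum-syntax; ∑-distrib-+; *-distribˡ-sum; sum-cong-≗)
  open +-*-Solver
  open ≡-Reasoning

  *-nonneg : ∀ {p q} → 0ℚ ≤ p → 0ℚ ≤ q → 0ℚ ≤ p * q
  *-nonneg {p} {q} 0≤p 0≤q =
    ℚ.nonNegative⁻¹ _ {{ℚ.nonNeg*nonNeg⇒nonNeg p {{nonNegative 0≤p}} q {{nonNegative 0≤q}}}}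

  p≤1⇒0≤1-p : ∀ {p} → p ≤ 1ℚ → 0ℚ ≤ 1ℚ - p
  p≤1⇒0≤1-p {p} p≤1 = ℚ.≤-trans (ℚ.≤-reflexive (sym (ℚ.+-inverseʳ p))) (ℚ.+-monoˡ-≤ (- p) p≤1)

  sumFin≡∑ : ∀ k (f : Vector ℚ k) → sumFin k f ≡ ∑[ l < k ] f l
  sumFin≡∑ zero    f = refl
  sumFin≡∑ (suc k) f = cong (f zero +_) (sumFin≡∑ k (f ∘ suc))

  ∑-nonneg : ∀ {k} (f : Vector ℚ k) → (∀ l → 0ℚ ≤ f l) → 0ℚ ≤ ∑[ l < k ] f l
  ∑-nonneg {zero}  f 0≤f = ℚ.≤-refl
  ∑-nonneg {suc k} f 0≤f = ℚ.+-mono-≤ (0≤f zero) (∑-nonneg (f ∘ suc) (0≤f ∘ suc))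

  ℕ→ℚ-* : ∀ a b → ℕ→ℚ (a ℕ.* b) ≡ ℕ→ℚ a * ℕ→ℚ b
  ℕ→ℚ-* a b = trans (sym (ℚ.↥p/↧p≡p (ℕ→ℚ (a ℕ.* b)))) (cong (_/ 1) (ℤ.pos-* a b))

  ℕ→ℚ-mono-≤ : ∀ {a b} → a ℕ.≤ b → ℕ→ℚ a ≤ ℕ→ℚ b
  ℕ→ℚ-mono-≤ a≤b = *≤* (ℤ.*-monoʳ-≤-nonNeg (ℤ.+ 1) (ℤ.+≤+ a≤b))

  ℕ→ℚ-nonneg : ∀ a → 0ℚ ≤ ℕ→ℚ a
  ℕ→ℚ-nonneg a = ℕ→ℚ-mono-≤ ℕ.z≤n

  InUnitInterval : ℚ → Set
  InUnitInterval p = 0ℚ ≤ p × p ≤ 1ℚ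

  ℕ→ℚ-÷-inUnitInterval : ∀ {a b} .{{_ : ℕ.NonZero b}} → a ℕ.≤ b → InUnitInterval (ℕ→ℚ a ÷ ℕ→ℚ b)
  ℕ→ℚ-÷-inUnitInterval {a} {b@(suc _)} a≤b =
    *-nonneg (ℕ→ℚ-nonneg a) 0≤1/b ,
    ℚ.≤-trans (ℚ.*-monoʳ-≤-nonNeg (1/ ℕ→ℚ b) {{nonNegative 0≤1/b}} (ℕ→ℚ-mono-≤ a≤b))
              (ℚ.≤-reflexive (ℚ.*-inverseʳ (ℕ→ℚ b)))
    where
    0≤1/b : 0ℚ ≤ 1/ ℕ→ℚ b
    0≤1/b = ℚ.nonNegative⁻¹ (1/ ℕ→ℚ b)

  *-÷-cancel : ∀ p q .{{_ : NonZero p}} → p * (q ÷ p) ≡ q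
  *-÷-cancel p q = begin
    p * (q * 1/ p)  ≡⟨ solve 3 (λ p q p⁻¹ → p :* (q :* p⁻¹) := q :* (p :* p⁻¹)) refl p q (1/ p) ⟩
    q * (p * 1/ p)  ≡⟨ cong (q *_) (ℚ.*-inverseʳ p) ⟩
    q * 1ℚ          ≡⟨ ℚ.*-identityʳ q ⟩
    q               ∎

  IsBit : ℚ → Set
  IsBit p = p ≡ 0ℚ ⊎ p ≡ 1ℚ

  bit-inUnitInterval : ∀ {p} → IsBit p → InUnitInterval p
  bit-inUnitInterval (inj₁ refl) = ℚ.≤-refl , ℚ.nonNegative⁻¹ 1ℚ
  bit-inUnitInterval (inj₂ refl) = ℚ.nonNegative⁻¹ 1ℚ , ℚ.≤-refl

  bit-nonneg : ∀ {p} → IsBit p → 0ℚ ≤ p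
  bit-nonneg = proj₁ ∘ bit-inUnitInterval

  bit-complement : ∀ {p} → IsBit p → IsBit (1ℚ - p)
  bit-complement (inj₁ refl) = inj₂ refl
  bit-complement (inj₂ refl) = inj₁ refl

  bit-* : ∀ {p q} → IsBit p → IsBit q → IsBit (p * q)
  bit-* {q = q} (inj₁ refl) _ = inj₁ (ℚ.*-zeroˡ q)
  bit-* (inj₂ refl) q-bit     = subst IsBit (sym (ℚ.*-identityˡ _)) q-bit

  δ : ∀ {K} → Fin K → Fin K → ℚ
  δ zero    zero    = 1ℚ
  δ zero    (suc _) = 0ℚ
  δ (suc _) zero    = 0ℚ
  δ (suc i) (suc j) = δ i j

  δ-refl : ∀ {K} (i : Fin K) → δ i i ≡ 1ℚ
  δ-refl zero    = refl
  δ-refl (suc i) = δ-refl i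

  δ-≢ : ∀ {K} {i j : Fin K} → i ≢ j → δ i j ≡ 0ℚ
  δ-≢ {i = zero}  {zero}  i≢j = ⊥-elim (i≢j refl)
  δ-≢ {i = zero}  {suc j} _   = refl
  δ-≢ {i = suc i} {zero}  _   = refl
  δ-≢ {i = suc i} {suc j} i≢j = δ-≢ (i≢j ∘ cong suc)

  δ-sym : ∀ {K} (i j : Fin K) → δ i j ≡ δ j i
  δ-sym zero    zero    = refl
  δ-sym zero    (suc j) = refl
  δ-sym (suc i) zero    = refl
  δ-sym (suc i) (suc j) = δ-sym i j

  δ-bit : ∀ {K} (i j : Fin K) → IsBit (δ i j)
  δ-bit zero    zero    = inj₂ refl
  δ-bit zero    (suc j) = inj₁ refl
  δ-bit (suc i) zero    = inj₁ refl
  δ-bit (suc i) (suc j) = δ-bit i j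

  ∑-δ : ∀ {K} (i : Fin K) (f : Vector ℚ K) → ∑[ l < K ] (δ i l * f l) ≡ f i
  ∑-δ {suc K} zero f = begin
    1ℚ * f zero + ∑[ l < K ] (0ℚ * f (suc l))
      ≡⟨ cong₂ _+_ (ℚ.*-identityˡ (f zero)) (sym (*-distribˡ-sum 0ℚ (f ∘ suc))) ⟩
    f zero + 0ℚ * ∑[ l < K ] f (suc l)
      ≡⟨ cong (f zero +_) (ℚ.*-zeroˡ (∑[ l < K ] f (suc l))) ⟩
    f zero + 0ℚ
      ≡⟨ ℚ.+-identityʳ (f zero) ⟩
    f zero ∎
  ∑-δ {suc K} (suc i) f = begin
    0ℚ * f zero + ∑[ l < K ] (δ i l * f (suc l)) ≡⟨ cong₂ _+_ (ℚ.*-zeroˡ (f zero)) (∑-δ i (f ∘ suc)) ⟩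
    0ℚ + f (suc i)                              ≡⟨ ℚ.+-identityˡ (f (suc i)) ⟩
    f (suc i)                                   ∎

  Cube : ℕ → Set
  Cube K = Fin K → Fin K → Fin K → ℚ

  distinct : ∀ {K} → Cube K
  distinct i j l = (1ℚ - δ i j) * ((1ℚ - δ i l) * (1ℚ - δ j l))

  distinct-sym₁₂ : ∀ {K} (i j l : Fin K) → distinct i j l ≡ distinct j i l
  distinct-sym₁₂ i j l =
    cong₂ _*_ (cong (_-_ 1ℚ) (δ-sym i j)) (ℚ.*-comm (1ℚ - δ i l) (1ℚ - δ j l))

  distinct-sym₂₃ : ∀ {K} (i j l : Fin K) → distinct i j l ≡ distinct i l j
  distinct-sym₂₃ i j l rewrite δ-sym l j =
    solve 3 (λ a b c → (con 1ℚ :- a) :* ((con 1ℚ :- b) :* (con 1ℚ :- c))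
                    := (con 1ℚ :- b) :* ((con 1ℚ :- a) :* (con 1ℚ :- c)))
      refl (δ i j) (δ i l) (δ j l)

  distinct-bit : ∀ {K} (i j l : Fin K) → IsBit (distinct i j l)
  distinct-bit i j l =
    bit-* (bit-complement (δ-bit i j)) (bit-* (bit-complement (δ-bit i l)) (bit-complement (δ-bit j l)))

  distinct-same : ∀ {K} (i l : Fin K) → distinct i i l ≡ 0ℚ
  distinct-same i l rewrite δ-refl i = ℚ.*-zeroˡ ((1ℚ - δ i l) * (1ℚ - δ i l))

  distinct+δ+δ≡1 : ∀ {K} {i j : Fin K} (l : Fin K) → i ≢ j → distinct i j l + δ i l + δ j l ≡ 1ℚ
  distinct+δ+δ≡1 {i = i} {j} l i≢j with i ≟ l | j ≟ l
  ... | yes refl | yes refl = ⊥-elim (i≢j refl)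
  ... | yes refl | no j≢l  rewrite δ-≢ i≢j | δ-refl i | δ-≢ j≢l = refl
  ... | no _     | yes refl rewrite δ-≢ i≢j | δ-refl j = refl
  ... | no i≢l   | no j≢l  rewrite δ-≢ i≢j | δ-≢ i≢l | δ-≢ j≢l = refl

  ∑-distinct : ∀ {K} {i j : Fin K} (t : Vector ℚ K) → i ≢ j →
    ∑[ l < K ] (distinct i j l * t l) + t i + t j ≡ ∑[ l < K ] t l
  ∑-distinct {K} {i} {j} t i≢j = begin
    ∑[ l < K ] (distinct i j l * t l) + t i + t j
      ≡⟨ cong₂ (λ x y → ∑[ l < K ] (distinct i j l * t l) + x + y) (∑-δ i t) (∑-δ j t) ⟨
    ∑[ l < K ] (distinct i j l * t l) + ∑[ l < K ] (δ i l * t l) + ∑[ l < K ] (δ j l * t l)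
      ≡⟨ trans (∑-distrib-+ (λ l → distinct i j l * t l + δ i l * t l) (λ l → δ j l * t l))
               (cong (_+ ∑[ l < K ] (δ j l * t l))
                     (∑-distrib-+ (λ l → distinct i j l * t l) (λ l → δ i l * t l))) ⟨
    ∑[ l < K ] (distinct i j l * t l + δ i l * t l + δ j l * t l)
      ≡⟨ sum-cong-≗ (λ l → trans (split l) (cong (_* t l) (distinct+δ+δ≡1 l i≢j))) ⟩
    ∑[ l < K ] (1ℚ * t l)
      ≡⟨ sum-cong-≗ (λ l → ℚ.*-identityˡ (t l)) ⟩
    ∑[ l < K ] t l ∎
    where
    split : ∀ l →
      distinct i j l * t l + δ i l * t l + δ j l * t l ≡ (distinct i j l + δ i l + δ j l) * t l
    split l = solve 4 (λ d a b x → d :* x :+ a :* x :+ b :* x := (d :+ a :+ b) :* x)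
      refl (distinct i j l) (δ i l) (δ j l) (t l)

  record IsHollowOutline {K : ℕ} (t : Vector ℚ K) (W : Cube K) : Set where
    field
      sym₁₂   : ∀ i j l → W i j l ≡ W j i l
      sym₂₃   : ∀ i j l → W i j l ≡ W i l j
      nonneg  : ∀ i j l → 0ℚ ≤ W i j l
      hollow  : ∀ i l → W i i l ≡ 0ℚ
      pairSum : ∀ i j → i ≢ j → ∑[ l < K ] W i j l ≡ t i * t j

  HollowOutline : ∀ {K} → Vector ℚ K → Set
  HollowOutline {K} t = Σ (Cube K) (IsHollowOutline t)

  hollow-resp-≗ : ∀ {K} {t t′ : Vector ℚ K} → t ≗ t′ → HollowOutline t → HollowOutline t′
  hollow-resp-≗ t≗t′ (W , isHollow) = W , record
    { IsHollowOutline isHollow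
    ; pairSum = λ i j i≢j → trans (pairSum i j i≢j) (cong₂ _*_ (t≗t′ i) (t≗t′ j))
    }
    where open IsHollowOutline isHollow

  diagonal : ∀ {K} → Vector ℚ K → Cube K
  diagonal x i j l = δ i j * (δ j l * x l)

  diagonal-same : ∀ {K} (x : Vector ℚ K) i → diagonal x i i i ≡ x i
  diagonal-same x i rewrite δ-refl i = trans (ℚ.*-identityˡ (1ℚ * x i)) (ℚ.*-identityˡ (x i))

  diagonal-≢₁₂ : ∀ {K} (x : Vector ℚ K) {i j} l → i ≢ j → diagonal x i j l ≡ 0ℚ
  diagonal-≢₁₂ x {j = j} l i≢j rewrite δ-≢ i≢j = ℚ.*-zeroˡ (δ j l * x l)

  diagonal-≢₂₃ : ∀ {K} (x : Vector ℚ K) i {j l} → j ≢ l → diagonal x i j l ≡ 0ℚ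
  diagonal-≢₂₃ x i {j} {l} j≢l rewrite δ-≢ j≢l =
    trans (cong (δ i j *_) (ℚ.*-zeroˡ (x l))) (ℚ.*-zeroʳ (δ i j))

  diagonal-sym₁₂ : ∀ {K} (x : Vector ℚ K) i j l → diagonal x i j l ≡ diagonal x j i l
  diagonal-sym₁₂ x i j l with i ≟ j
  ... | yes refl = refl
  ... | no i≢j   = trans (diagonal-≢₁₂ x l i≢j) (sym (diagonal-≢₁₂ x l (i≢j ∘ sym)))

  diagonal-sym₂₃ : ∀ {K} (x : Vector ℚ K) i j l → diagonal x i j l ≡ diagonal x i l j
  diagonal-sym₂₃ x i j l with j ≟ l
  ... | yes refl = refl
  ... | no j≢l   = trans (diagonal-≢₂₃ x i j≢l) (sym (diagonal-≢₂₃ x i (j≢l ∘ sym)))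

  diagonal-nonneg : ∀ {K} {x : Vector ℚ K} → (∀ i → 0ℚ ≤ x i) → ∀ i j l → 0ℚ ≤ diagonal x i j l
  diagonal-nonneg 0≤x i j l =
    *-nonneg (bit-nonneg (δ-bit i j)) (*-nonneg (bit-nonneg (δ-bit j l)) (0≤x l))

  ∑-diagonal : ∀ {K} (x : Vector ℚ K) i → ∑[ l < K ] diagonal x i i l ≡ x i
  ∑-diagonal x i rewrite δ-refl i = trans (sum-cong-≗ (λ l → ℚ.*-identityˡ (δ i l * x l))) (∑-δ i x)

  ROS-fromHollow : ∀ {K} (P : Fin K → ℕ) (h : ℚ) (t : Vector ℚ K) → 0ℚ ≤ h →
    (∀ i → h * t i ≡ ℕ→ℚ (P i)) → HollowOutline t → ROS K P
  ROS-fromHollow {K} P h t 0≤h h*t≡P (W , isHollow) = O , record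
    { symm₁₂  = λ i j l → cong₂ _+_ (diagonal-sym₁₂ P² i j l) (cong (h * h *_) (sym₁₂ i j l))
    ; symm₂₃  = λ i j l → cong₂ _+_ (diagonal-sym₂₃ P² i j l) (cong (h * h *_) (sym₂₃ i j l))
    ; nonneg  = λ i j l → ℚ.+-mono-≤ (diagonal-nonneg (λ i → ℕ→ℚ-nonneg (P i ℕ.* P i)) i j l)
                                     (*-nonneg (*-nonneg 0≤h 0≤h) (nonneg i j l))
    ; lineSum = λ i j → trans (sumFin≡∑ K (O i j)) (∑-O i j)
    ; diag    = λ i → trans (cong₂ _+_ (diagonal-same P² i) (h²W-hollow i i)) (ℚ.+-identityʳ (P² i))
    ; offdiag = λ i j i≢j → cong₂ _+_ (diagonal-≢₂₃ P² i i≢j) (h²W-hollow i j)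
    }
    where
    open IsHollowOutline isHollow

    P² : Vector ℚ K
    P² i = ℕ→ℚ (P i ℕ.* P i)

    O : Cube K
    O i j l = diagonal P² i j l + h * h * W i j l

    h²W-hollow : ∀ i l → h * h * W i i l ≡ 0ℚ
    h²W-hollow i l = trans (cong (h * h *_) (hollow i l)) (ℚ.*-zeroʳ (h * h))

    ∑-O : ∀ i j → ∑[ l < K ] O i j l ≡ ℕ→ℚ (P i ℕ.* P j)
    ∑-O i j with i ≟ j
    ... | yes refl = begin
      ∑[ l < K ] O i i l
        ≡⟨ sum-cong-≗ (λ l → trans (cong (diagonal P² i i l +_) (h²W-hollow i l))
                                   (ℚ.+-identityʳ (diagonal P² i i l))) ⟩
      ∑[ l < K ] diagonal P² i i l
        ≡⟨ ∑-diagonal P² i ⟩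
      P² i ∎
    ... | no i≢j = begin
      ∑[ l < K ] O i j l
        ≡⟨ sum-cong-≗ (λ l → trans (cong (_+ h * h * W i j l) (diagonal-≢₁₂ P² l i≢j))
                                   (ℚ.+-identityˡ (h * h * W i j l))) ⟩
      ∑[ l < K ] (h * h * W i j l)
        ≡⟨ *-distribˡ-sum (h * h) (W i j) ⟨
      h * h * ∑[ l < K ] W i j l
        ≡⟨ cong (h * h *_) (pairSum i j i≢j) ⟩
      h * h * (t i * t j)
        ≡⟨ solve 3 (λ h x y → h :* h :* (x :* y) := h :* x :* (h :* y)) refl h (t i) (t j) ⟩
      h * t i * (h * t j)
        ≡⟨ cong₂ _*_ (h*t≡P i) (h*t≡P j) ⟩
      ℕ→ℚ (P i) * ℕ→ℚ (P j)
        ≡⟨ ℕ→ℚ-* (P i) (P j) ⟨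
      ℕ→ℚ (P i ℕ.* P j) ∎

  hollow-bits : ∀ {K} (t : Vector ℚ K) → (∀ a → IsBit (t a)) →
    {{_ : Positive (∑[ l < K ] t l - 1ℚ - 1ℚ)}} → HollowOutline t
  hollow-bits {K} t t-bit = W , record
    { sym₁₂   = λ i j l → cong₂ (λ d p → c * (d * p)) (distinct-sym₁₂ i j l)
                                 (cong (_* t l) (ℚ.*-comm (t i) (t j)))
    ; sym₂₃   = λ i j l → cong₂ (λ d p → c * (d * p)) (distinct-sym₂₃ i j l)
                                 (solve 3 (λ x y z → x :* y :* z := x :* z :* y) refl (t i) (t j) (t l))
    ; nonneg  = λ i j l → *-nonneg 0≤c (bit-nonneg (bit-* (distinct-bit i j l)
                                         (bit-* (bit-* (t-bit i) (t-bit j)) (t-bit l))))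
    ; hollow  = λ i l → trans (cong (λ d → c * (d * (t i * t i * t l))) (distinct-same i l))
                               (solve 2 (λ c p → c :* (con 0ℚ :* p) := con 0ℚ) refl c (t i * t i * t l))
    ; pairSum = pairSum
    }
    where
    excess : ℚ
    excess = ∑[ l < K ] t l - 1ℚ - 1ℚ

    instance
      excess≢0 : NonZero excess
      excess≢0 = ℚ.pos⇒nonZero excess

    c : ℚ
    c = 1/ excess

    0≤c : 0ℚ ≤ c
    0≤c = ℚ.nonNegative⁻¹ c {{ℚ.pos⇒nonNeg c {{ℚ.1/pos⇒pos excess}}}}

    W : Cube K
    W i j l = c * (distinct i j l * (t i * t j * t l))

    bits-pairSum : ∀ {p q} (A : ℚ) → IsBit p → IsBit q → A + p + q ≡ ∑[ l < K ] t l →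
      c * (p * q) * A ≡ p * q
    bits-pairSum {q = q} A (inj₁ refl) _ _ =
      solve 3 (λ c q A → c :* (con 0ℚ :* q) :* A := con 0ℚ :* q) refl c q A
    bits-pairSum A (inj₂ refl) (inj₁ refl) _ =
      solve 2 (λ c A → c :* (con 1ℚ :* con 0ℚ) :* A := con 1ℚ :* con 0ℚ) refl c A
    bits-pairSum A (inj₂ refl) (inj₂ refl) A+2≡∑t = begin
      c * (1ℚ * 1ℚ) * A
        ≡⟨ cong (_* A) (ℚ.*-identityʳ c) ⟩
      c * A
        ≡⟨ cong (c *_) (solve 1 (λ A → A := A :+ con 1ℚ :+ con 1ℚ :- con 1ℚ :- con 1ℚ) refl A) ⟩
      c * (A + 1ℚ + 1ℚ - 1ℚ - 1ℚ)
        ≡⟨ cong (λ T → c * (T - 1ℚ - 1ℚ)) A+2≡∑t ⟩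
      c * excess
        ≡⟨ ℚ.*-inverseˡ excess ⟩
      1ℚ ∎

    pairSum : ∀ i j → i ≢ j → ∑[ l < K ] W i j l ≡ t i * t j
    pairSum i j i≢j = begin
      ∑[ l < K ] W i j l
        ≡⟨ sum-cong-≗ regroup ⟩
      ∑[ l < K ] (c * (t i * t j) * (distinct i j l * t l))
        ≡⟨ *-distribˡ-sum (c * (t i * t j)) (λ l → distinct i j l * t l) ⟨
      c * (t i * t j) * ∑[ l < K ] (distinct i j l * t l)
        ≡⟨ bits-pairSum _ (t-bit i) (t-bit j) (∑-distinct t i≢j) ⟩
      t i * t j ∎
      where
      regroup : ∀ l → W i j l ≡ c * (t i * t j) * (distinct i j l * t l)
      regroup l = solve 5 (λ c d x y z → c :* (d :* (x :* y :* z)) := c :* (x :* y) :* (d :* z))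
        refl c (distinct i j l) (t i) (t j) (t l)

  hollow-convex : ∀ {K} {t t₀ t₁ : Vector ℚ K} (s : ℚ) → InUnitInterval s →
    (∀ i j → i ≢ j → (1ℚ - s) * (t₀ i * t₀ j) + s * (t₁ i * t₁ j) ≡ t i * t j) →
    HollowOutline t₀ → HollowOutline t₁ → HollowOutline t
  hollow-convex {K} {t} {t₀} {t₁} s (0≤s , s≤1) mix (W₀ , isHollow₀) (W₁ , isHollow₁) = W , record
    { sym₁₂   = λ i j l → cong₂ combine (H₀.sym₁₂ i j l) (H₁.sym₁₂ i j l)
    ; sym₂₃   = λ i j l → cong₂ combine (H₀.sym₂₃ i j l) (H₁.sym₂₃ i j l)
    ; nonneg  = λ i j l → ℚ.+-mono-≤ (*-nonneg (p≤1⇒0≤1-p s≤1) (H₀.nonneg i j l))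
                                     (*-nonneg 0≤s (H₁.nonneg i j l))
    ; hollow  = λ i l → trans (cong₂ combine (H₀.hollow i l) (H₁.hollow i l))
                              (solve 1 (λ s → (con 1ℚ :- s) :* con 0ℚ :+ s :* con 0ℚ := con 0ℚ) refl s)
    ; pairSum = pairSum
    }
    where
    module H₀ = IsHollowOutline isHollow₀
    module H₁ = IsHollowOutline isHollow₁

    combine : ℚ → ℚ → ℚ
    combine w₀ w₁ = (1ℚ - s) * w₀ + s * w₁

    W : Cube K
    W i j l = combine (W₀ i j l) (W₁ i j l)

    pairSum : ∀ i j → i ≢ j → ∑[ l < K ] W i j l ≡ t i * t j
    pairSum i j i≢j = begin
      ∑[ l < K ] W i j l
        ≡⟨ ∑-distrib-+ (λ l → (1ℚ - s) * W₀ i j l) (λ l → s * W₁ i j l) ⟩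
      ∑[ l < K ] ((1ℚ - s) * W₀ i j l) + ∑[ l < K ] (s * W₁ i j l)
        ≡⟨ cong₂ _+_ (*-distribˡ-sum (1ℚ - s) (W₀ i j)) (*-distribˡ-sum s (W₁ i j)) ⟨
      combine (∑[ l < K ] W₀ i j l) (∑[ l < K ] W₁ i j l)
        ≡⟨ cong₂ combine (H₀.pairSum i j i≢j) (H₁.pairSum i j i≢j) ⟩
      combine (t₀ i * t₀ j) (t₁ i * t₁ j)
        ≡⟨ mix i j i≢j ⟩
      t i * t j ∎

  _[_]≔_ : ∀ {m} → Vector ℚ m → Fin m → ℚ → Vector ℚ m
  r [ b ]≔ v = updateAt r b (const v)

  []≔-updates : ∀ {m} (r : Vector ℚ m) b {v} → (r [ b ]≔ v) b ≡ v
  []≔-updates r b = updateAt-updates b r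

  []≔-minimal : ∀ {m} (r : Vector ℚ m) {a b v} → a ≢ b → (r [ b ]≔ v) a ≡ r a
  []≔-minimal r {a} {b} = updateAt-minimal a b r

  []≔-pointwise : ∀ {m} (P : Fin m → ℚ → Set) {r : Vector ℚ m} {b v} →
    P b v → (∀ a → a ≢ b → P a (r a)) → ∀ a → P a ((r [ b ]≔ v) a)
  []≔-pointwise P {r} {b} Pbv Pr a with a ≟ b
  ... | yes refl = subst (P a) (sym ([]≔-updates r a)) Pbv
  ... | no a≢b   = subst (P a) (sym ([]≔-minimal r a≢b)) (Pr a a≢b)

  pairProduct-interpolate : ∀ {K} (t : Vector ℚ K) b {i j} → i ≢ j →
    (1ℚ - t b) * ((t [ b ]≔ 0ℚ) i * (t [ b ]≔ 0ℚ) j) + t b * ((t [ b ]≔ 1ℚ) i * (t [ b ]≔ 1ℚ) j)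
      ≡ t i * t j
  pairProduct-interpolate t b {i} {j} i≢j with i ≟ b | j ≟ b
  ... | yes refl | yes refl = ⊥-elim (i≢j refl)
  ... | yes refl | no j≢b
    rewrite []≔-updates t i {0ℚ} | []≔-updates t i {1ℚ}
          | []≔-minimal t {v = 0ℚ} j≢b | []≔-minimal t {v = 1ℚ} j≢b =
    solve 2 (λ s y → (con 1ℚ :- s) :* (con 0ℚ :* y) :+ s :* (con 1ℚ :* y) := s :* y) refl (t i) (t j)
  ... | no i≢b   | yes refl
    rewrite []≔-updates t j {0ℚ} | []≔-updates t j {1ℚ}
          | []≔-minimal t {v = 0ℚ} i≢b | []≔-minimal t {v = 1ℚ} i≢b =
    solve 2 (λ s x → (con 1ℚ :- s) :* (x :* con 0ℚ) :+ s :* (x :* con 1ℚ) := x :* s) refl (t j) (t i)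
  ... | no i≢b   | no j≢b
    rewrite []≔-minimal t {v = 0ℚ} i≢b | []≔-minimal t {v = 1ℚ} i≢b
          | []≔-minimal t {v = 0ℚ} j≢b | []≔-minimal t {v = 1ℚ} j≢b =
    solve 2 (λ s p → (con 1ℚ :- s) :* p :+ s :* p := p) refl (t b) (t i * t j)

  hollow-interpolate : ∀ {K} (t : Vector ℚ K) b → InUnitInterval (t b) →
    HollowOutline (t [ b ]≔ 0ℚ) → HollowOutline (t [ b ]≔ 1ℚ) → HollowOutline t
  hollow-interpolate t b t_b∈I = hollow-convex (t b) t_b∈I (λ i j → pairProduct-interpolate t b)

  unitBox-induction : ∀ {m} (Q : Vector ℚ m → Set) →
    (∀ r b → InUnitInterval (r b) → Q (r [ b ]≔ 0ℚ) → Q (r [ b ]≔ 1ℚ) → Q r) →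
    (∀ r → (∀ a → IsBit (r a)) → Q r) →
    ∀ r → (∀ a → InUnitInterval (r a)) → Q r
  unitBox-induction {m} Q interpolate vertex r r∈I = go (allFin m) r r∈I (λ a → inj₁ (∈-allFin a))
    where
    go : (L : List (Fin m)) → ∀ r → (∀ a → InUnitInterval (r a)) → (∀ a → a ∈ L ⊎ IsBit (r a)) → Q r
    go []            r _   free = vertex r (λ a → [ (λ ()) , id ]′ (free a))
    go (b List.∷ L) r r∈I free =
      interpolate r b (r∈I b) (go-fixed 0ℚ (inj₁ refl)) (go-fixed 1ℚ (inj₂ refl))
      where
      go-fixed : ∀ v → IsBit v → Q (r [ b ]≔ v)
      go-fixed v v-bit = go L (r [ b ]≔ v)
        ([]≔-pointwise (λ _ → InUnitInterval) (bit-inUnitInterval v-bit) (λ a _ → r∈I a))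
        ([]≔-pointwise (λ a p → a ∈ L ⊎ IsBit p) (inj₂ v-bit) free-off-b)
        where
        free-off-b : ∀ a → a ≢ b → a ∈ L ⊎ IsBit (r a)
        free-off-b a a≢b with free a
        ... | inj₁ (here a≡b)  = ⊥-elim (a≢b a≡b)
        ... | inj₁ (there a∈L) = inj₁ a∈L
        ... | inj₂ r_a-bit     = inj₂ r_a-bit

  ones-[]≔ : ∀ {m} (r : Vector ℚ m) b v →
    (1ℚ ∷ 1ℚ ∷ 1ℚ ∷ r) [ suc (suc (suc b)) ]≔ v ≗ 1ℚ ∷ 1ℚ ∷ 1ℚ ∷ (r [ b ]≔ v)
  ones-[]≔ r b v zero                = refl
  ones-[]≔ r b v (suc zero)          = refl
  ones-[]≔ r b v (suc (suc zero))    = refl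
  ones-[]≔ r b v (suc (suc (suc a))) = refl

  hollow-unitBox : ∀ {m} (r : Vector ℚ m) → (∀ a → InUnitInterval (r a)) →
    HollowOutline (1ℚ ∷ 1ℚ ∷ 1ℚ ∷ r)
  hollow-unitBox = unitBox-induction (λ r → HollowOutline (1ℚ ∷ 1ℚ ∷ 1ℚ ∷ r)) interpolate vertex
    where
    interpolate : ∀ {m} (r : Vector ℚ m) b → InUnitInterval (r b) →
      HollowOutline (1ℚ ∷ 1ℚ ∷ 1ℚ ∷ (r [ b ]≔ 0ℚ)) → HollowOutline (1ℚ ∷ 1ℚ ∷ 1ℚ ∷ (r [ b ]≔ 1ℚ)) →
      HollowOutline (1ℚ ∷ 1ℚ ∷ 1ℚ ∷ r)
    interpolate r b r_b∈I H₀ H₁ = hollow-interpolate (1ℚ ∷ 1ℚ ∷ 1ℚ ∷ r) (suc (suc (suc b))) r_b∈I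
      (hollow-resp-≗ (sym ∘ ones-[]≔ r b 0ℚ) H₀) (hollow-resp-≗ (sym ∘ ones-[]≔ r b 1ℚ) H₁)

    vertex : ∀ {m} (r : Vector ℚ m) → (∀ a → IsBit (r a)) → HollowOutline (1ℚ ∷ 1ℚ ∷ 1ℚ ∷ r)
    vertex {m} r r-bit = hollow-bits (1ℚ ∷ 1ℚ ∷ 1ℚ ∷ r) t-bit {{subst Positive excess≡1+∑r 1+∑r-pos}}
      where
      t-bit : ∀ a → IsBit ((1ℚ ∷ 1ℚ ∷ 1ℚ ∷ r) a)
      t-bit zero                = inj₂ refl
      t-bit (suc zero)          = inj₂ refl
      t-bit (suc (suc zero))    = inj₂ refl
      t-bit (suc (suc (suc a))) = r-bit a

      ∑r : ℚ
      ∑r = ∑[ a < m ] r a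

      1+∑r-pos : Positive (1ℚ + ∑r)
      1+∑r-pos = ℚ.pos+nonNeg⇒pos 1ℚ ∑r {{nonNegative (∑-nonneg r (bit-nonneg ∘ r-bit))}}

      excess≡1+∑r : 1ℚ + ∑r ≡ 1ℚ + (1ℚ + (1ℚ + ∑r)) - 1ℚ - 1ℚ
      excess≡1+∑r =
        solve 1 (λ S → con 1ℚ :+ S := con 1ℚ :+ (con 1ℚ :+ (con 1ℚ :+ S)) :- con 1ℚ :- con 1ℚ) refl ∑r

open RationalOutlineSquares
  using (InUnitInterval; ROS-fromHollow; hollow-unitBox; ℕ→ℚ-nonneg; ℕ→ℚ-÷-inUnitInterval; *-÷-cancel)
open import Data.Nat using (ℕ; _+_; _≤_; _<_)
open import Data.Fin using (Fin)
import Data.Fin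
open import Data.Fin.Base using (zero; suc)
open import Data.Nat.Base using (NonZero; >-nonZero)
open import Data.Rational.Base using (ℚ; 1ℚ; _*_; _÷_)
import Data.Rational.Properties as ℚ
open import Data.Vec.Functional using (_∷_)
open import Relation.Binary.PropositionalEquality using (_≡_)

mainTheorem4 : (m : ℕ) (h₁ : ℕ) (hs : Fin m → ℕ) →
    0 < h₁ →
    (∀ i → hs i ≤ h₁) →
    (∀ (i j : Fin m) → i Data.Fin.≤ j → hs j ≤ hs i) →
    (∀ i → 0 < hs i) →
    ROS (3 + m) (seq3 h₁ m hs)
mainTheorem4 m h₁ hs 0<h₁ hs≤h₁ _ _ =
  ROS-fromHollow (seq3 h₁ m hs) H t (ℕ→ℚ-nonneg h₁) H*t≡h (hollow-unitBox r r∈[0,1])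
  where
  instance
    h₁≢0 : NonZero h₁
    h₁≢0 = >-nonZero 0<h₁

  H : ℚ
  H = ℕ→ℚ h₁

  r : Fin m → ℚ
  r a = ℕ→ℚ (hs a) ÷ H

  r∈[0,1] : ∀ a → InUnitInterval (r a)
  r∈[0,1] a = ℕ→ℚ-÷-inUnitInterval (hs≤h₁ a)

  t : Fin (3 + m) → ℚ
  t = 1ℚ ∷ 1ℚ ∷ 1ℚ ∷ r

  H*t≡h : ∀ i → H * t i ≡ ℕ→ℚ (seq3 h₁ m hs i)
  H*t≡h zero                = ℚ.*-identityʳ H
  H*t≡h (suc zero)          = ℚ.*-identityʳ H
  H*t≡h (suc (suc zero))    = ℚ.*-identityʳ H
  H*t≡h (suc (suc (suc a))) = *-÷-cancel H (ℕ→ℚ (hs a))
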